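{- For any circle graph $G=(V,E)$, $\psi(G) \ge an(G)$.
   Context: A circle graph is the intersection graph of a finite set of chords of a circle. For $k \ge 3$, a $k$-polygon graph is the intersection graph of a finite set of chords of a convex $k$-sided polygon with each chord having its endpoints on two distinct sides; $2$-polygon graphs are the permutation graphs. The polygon number $\psi(G)$ of a circle graph $G$ is the minimum $k\ge 2$ such that $G$ is a $k$-polygon graph. A set $A \subseteq V$ is an asteroidal set if for every $a \in A$, every two vertices $x,y \in A\setminus\{a\}$ are joined by a path in $G - N[a]$ (where $N[a]$ is the closed neighbourhood of $a$). The asteroidal number $an(G)$ is the maximum cardinality of an asteroidal set of $G$. -}

module Defs where

open import Level using (0ℓ)
open import Data.Nat using (ℕ; _<_; _≤_)
open import Data.Fin using (Fin) renaming (_≤_ to _≤ᶠ_)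
open import Data.Fin.Subset using (Subset; _∈_; ∣_∣)
open import Data.Sum using (_⊎_; inj₁; inj₂)
open import Data.Product using (_×_; Σ)
open import Relation.Nullary using (¬_)
open import Relation.Binary.PropositionalEquality using (_≡_; _≢_)
open import Function.Bundles using (_⇔_)
open import Function.Definitions using (Injective)

record Graph (n : ℕ) : Set₁ where
  field
    E     : Fin n → Fin n → Set
    sym   : ∀ {u v} → E u v → E v u
    irrefl : ∀ {v} → ¬ E v v
open Graph public

-- Chord i has two endpoints, inj₁ i and inj₂ i.  Endpoints are placed at
-- pairwise distinct positions (natural numbers) along the boundary of the
-- circle / polygon, read in the cyclic order starting at some cut point
-- (for polygons: starting at the corner that begins side 0).

Endpoint : ℕ → Set
Endpoint n = Fin n ⊎ Fin n

Between : ℕ → ℕ → ℕ → Set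
Between p a b = (a < p × p < b) ⊎ (b < p × p < a)

_xor_ : Set → Set → Set
A xor B = (A × ¬ B) ⊎ (¬ A × B)

record ChordModel (n : ℕ) : Set where
  field
    pos      : Endpoint n → ℕ
    pos-inj  : Injective _≡_ _≡_ pos
open ChordModel public

-- Two chords cross iff their endpoints interleave in the cyclic order,
-- i.e. exactly one endpoint of j lies between the two endpoints of i.
Cross : ∀ {n} → ChordModel n → Fin n → Fin n → Set
Cross M i j =
  Between (pos M (inj₁ j)) (pos M (inj₁ i)) (pos M (inj₂ i))
  xor Between (pos M (inj₂ j)) (pos M (inj₁ i)) (pos M (inj₂ i))

Represents : ∀ {n} → ChordModel n → Graph n → Set
Represents M G = ∀ i j → i ≢ j → (E G i j ⇔ Cross M i j)

IsCircleGraph : ∀ {n} → Graph n → Set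
IsCircleGraph {n} G = Σ (ChordModel n) λ M → Represents M G

-- A k-polygon model: chord model plus an assignment of each endpoint to one
-- of the k sides, such that sides are consecutive arcs of the boundary
-- (side index is monotone in position) and every chord has its two
-- endpoints on distinct sides.
record PolygonModel (k n : ℕ) : Set where
  field
    chords   : ChordModel n
    side     : Endpoint n → Fin k
    side-mono : ∀ p q → pos chords p < pos chords q → side p ≤ᶠ side q
    side-distinct : ∀ i → side (inj₁ i) ≢ side (inj₂ i)
open PolygonModel public

IsPolygonGraph : ℕ → ∀ {n} → Graph n → Set
IsPolygonGraph k {n} G =
  Σ (PolygonModel k n) λ P → Represents (chords P) G

IsPolygonNumber : ∀ {n} → Graph n → ℕ → Set
IsPolygonNumber G p =
  (2 ≤ p × IsPolygonGraph p G)
  × (∀ k → 2 ≤ k → IsPolygonGraph k G → p ≤ k)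

InClosedNbhd : ∀ {n} → Graph n → Fin n → Fin n → Set
InClosedNbhd G a v = v ≡ a ⊎ E G a v

data PathAvoiding {n} (G : Graph n) (a : Fin n) : Fin n → Fin n → Set where
  here : ∀ {x} → ¬ InClosedNbhd G a x → PathAvoiding G a x x
  step : ∀ {x z y} → ¬ InClosedNbhd G a x → E G x z →
         PathAvoiding G a z y → PathAvoiding G a x y

IsAsteroidal : ∀ {n} → Graph n → Subset n → Set
IsAsteroidal G A =
  ∀ a x y → a ∈ A → x ∈ A → y ∈ A → x ≢ a → y ≢ a → x ≢ y →
  PathAvoiding G a x y

IsAsteroidalNumber : ∀ {n} → Graph n → ℕ → Set
IsAsteroidalNumber {n} G m =
  Σ (Subset n) (λ A → IsAsteroidal G A × ∣ A ∣ ≡ m)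
  × (∀ (A : Subset n) → IsAsteroidal G A → ∣ A ∣ ≤ m)

-- Fix a k-polygon model and an asteroidal set A, and view every chord as the interval between its
-- two endpoints along the boundary.  A path of G − N[a] never crosses chord a, so the left endpoints
-- of its chords stay on one side of a.  Hence if some other member of A starts inside a ∈ A, then all
-- of them do: a encloses the rest of A.  At most one member of A encloses the others, and the
-- remaining members are pairwise disjoint intervals.  Sending an enclosing member to the side of its
-- left endpoint and every other member to the side of its right endpoint is therefore injective on A,
-- which gives ∣A∣ ≤ k.
module Submission where

open import Defs hiding (sym)
open import Data.Nat as ℕ using (ℕ; _≤_; _<_)
open import Data.Nat.Properties
  using (<-trans; <-asym; <-cmp; _<?_; ≮⇒≥; ≤∧≢⇒<; ≤-<-trans)
open import Data.Fin using (Fin; zero; suc) renaming (_<_ to _<ᶠ_)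
open import Data.Fin.Properties using (suc-injective; toℕ-injective; injective⇒≤; any?; <⇒≢)
  renaming (_≟_ to _≟ᶠ_)
open import Data.Fin.Subset using (Subset; _∈_; ∣_∣; inside; outside)
open import Data.Fin.Subset.Properties using (_∈?_)
open import Data.Vec using (_∷_; [])
open import Data.Vec.Base using (here; there)
open import Data.Sum using (inj₁; inj₂)
open import Data.Product using (Σ; ∃; _×_; _,_; proj₁)
open import Relation.Nullary using (Dec; yes; no; ¬_)
open import Relation.Nullary.Decidable using (_×-dec_; ¬?)
open import Relation.Binary using (tri<; tri≈; tri>)
open import Relation.Binary.PropositionalEquality using (_≡_; _≢_; refl; sym; trans; cong; subst)
open import Function.Bundles using (_⇔_; mk⇔; Equivalence)
open import Function.Definitions using (Injective)
open import Data.Empty using (⊥-elim)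

InjectiveOn : ∀ {n k} → Subset n → (Fin n → Fin k) → Set
InjectiveOn A f = ∀ {x y} → x ∈ A → y ∈ A → f x ≡ f y → x ≡ y

enumerate : ∀ {n} (A : Subset n) →
            Σ (Fin ∣ A ∣ → Fin n) λ e → Injective _≡_ _≡_ e × (∀ i → e i ∈ A)
enumerate [] = (λ ()) , (λ {}) , λ ()
enumerate (outside ∷ A) with enumerate A
... | e , e-inj , e∈A = (λ i → suc (e i)) , (λ eq → e-inj (suc-injective eq)) , λ i → there (e∈A i)
enumerate (inside ∷ A) with enumerate A
... | e , e-inj , e∈A = e′ , e′-inj , e′∈A
  where
  e′ : Fin (ℕ.suc ∣ A ∣) → Fin _
  e′ zero    = zero
  e′ (suc i) = suc (e i)
  e′-inj : Injective _≡_ _≡_ e′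
  e′-inj {zero}  {zero}  _  = refl
  e′-inj {suc i} {suc j} eq = cong suc (e-inj (suc-injective eq))
  e′∈A : ∀ i → e′ i ∈ inside ∷ A
  e′∈A zero    = here
  e′∈A (suc i) = there (e∈A i)

injectiveOn⇒∣∣≤ : ∀ {n k} (A : Subset n) (f : Fin n → Fin k) → InjectiveOn A f → ∣ A ∣ ≤ k
injectiveOn⇒∣∣≤ A f f-inj with enumerate A
... | e , e-inj , e∈A = injective⇒≤ {f = λ i → f (e i)} λ eq → e-inj (f-inj (e∈A _) (e∈A _) eq)

xor-comm : ∀ {P Q} → P xor Q → Q xor P
xor-comm (inj₁ (p , ¬q)) = inj₂ (¬q , p)
xor-comm (inj₂ (¬p , q)) = inj₁ (q , ¬p)

xor-cong : ∀ {P P′ Q Q′} → P ⇔ P′ → Q ⇔ Q′ → P xor Q → P′ xor Q′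
xor-cong P⇔P′ Q⇔Q′ (inj₁ (p , ¬q)) =
  inj₁ (Equivalence.to P⇔P′ p , λ q′ → ¬q (Equivalence.from Q⇔Q′ q′))
xor-cong P⇔P′ Q⇔Q′ (inj₂ (¬p , q)) =
  inj₂ ((λ p′ → ¬p (Equivalence.from P⇔P′ p′)) , Equivalence.to Q⇔Q′ q)

xor-cong-⇔ : ∀ {P P′ Q Q′} → P ⇔ P′ → Q ⇔ Q′ → (P xor Q) ⇔ (P′ xor Q′)
xor-cong-⇔ P⇔P′ Q⇔Q′ = mk⇔ (xor-cong P⇔P′ Q⇔Q′) (xor-cong (sym-⇔ P⇔P′) (sym-⇔ Q⇔Q′))
  where
  sym-⇔ : ∀ {P Q} → P ⇔ Q → Q ⇔ P
  sym-⇔ P⇔Q = mk⇔ (Equivalence.from P⇔Q) (Equivalence.to P⇔Q)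

Between-sym : ∀ {q a b} → Between q a b → Between q b a
Between-sym (inj₁ x) = inj₂ x
Between-sym (inj₂ x) = inj₁ x

Between-ordered : ∀ {q a b} → a < b → Between q a b → a < q × q < b
Between-ordered a<b (inj₁ a<q<b)       = a<q<b
Between-ordered a<b (inj₂ (b<q , q<a)) = ⊥-elim (<-asym a<b (<-trans b<q q<a))

chordOf : ∀ {n} → Endpoint n → Fin n
chordOf (inj₁ i) = i
chordOf (inj₂ i) = i

module Intervals {n : ℕ} (M : ChordModel n) where

  Orientation : Fin n → Set
  Orientation i = Dec (pos M (inj₁ i) < pos M (inj₂ i))

  -- Lemmas about lo′/hi′ are proved for an arbitrary orientation d, so that matching on d
  -- makes lo i = lo′ i (orientation i) compute.
  lo′ hi′ : ∀ i → Orientation i → Endpoint n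
  lo′ i (yes _) = inj₁ i
  lo′ i (no _)  = inj₂ i
  hi′ i (yes _) = inj₂ i
  hi′ i (no _)  = inj₁ i

  orientation : ∀ i → Orientation i
  orientation i = pos M (inj₁ i) <? pos M (inj₂ i)

  lo hi : Fin n → Endpoint n
  lo i = lo′ i (orientation i)
  hi i = hi′ i (orientation i)

  ℓ h : Fin n → ℕ
  ℓ i = pos M (lo i)
  h i = pos M (hi i)

  chordOf-lo′ : ∀ i d → chordOf (lo′ i d) ≡ i
  chordOf-lo′ i (yes _) = refl
  chordOf-lo′ i (no _)  = refl

  chordOf-hi′ : ∀ i d → chordOf (hi′ i d) ≡ i
  chordOf-hi′ i (yes _) = refl
  chordOf-hi′ i (no _)  = refl

  ℓ<h′ : ∀ i d → pos M (lo′ i d) < pos M (hi′ i d)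
  ℓ<h′ i (yes p₁<p₂) = p₁<p₂
  ℓ<h′ i (no p₁≮p₂)  = ≤∧≢⇒< (≮⇒≥ p₁≮p₂) λ p₂≡p₁ → ends-distinct (pos-inj M p₂≡p₁)
    where
    ends-distinct : inj₂ i ≢ inj₁ i
    ends-distinct ()

  ℓ-injective : ∀ {i j} → ℓ i ≡ ℓ j → i ≡ j
  ℓ-injective {i} {j} eq = trans (sym (chordOf-lo′ i (orientation i)))
    (trans (cong chordOf (pos-inj M eq)) (chordOf-lo′ j (orientation j)))

  h≡ℓ⇒≡ : ∀ {i j} → h i ≡ ℓ j → i ≡ j
  h≡ℓ⇒≡ {i} {j} eq = trans (sym (chordOf-hi′ i (orientation i)))
    (trans (cong chordOf (pos-inj M eq)) (chordOf-lo′ j (orientation j)))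

  Inside : ℕ → Fin n → Set
  Inside q i = ℓ i < q × q < h i

  Inside? : ∀ q i → Dec (Inside q i)
  Inside? q i = (ℓ i <? q) ×-dec (q <? h i)

  Inside-trans : ∀ {q x a} → Inside q x → Inside (ℓ x) a → Inside (h x) a → Inside q a
  Inside-trans (ℓx<q , q<hx) (ℓa<ℓx , _) (_ , hx<ha) = <-trans ℓa<ℓx ℓx<q , <-trans q<hx hx<ha

  Between⇔Inside′ : ∀ q i d → Between q (pos M (inj₁ i)) (pos M (inj₂ i)) ⇔
                               (pos M (lo′ i d) < q × q < pos M (hi′ i d))
  Between⇔Inside′ q i d@(yes _) = mk⇔ (Between-ordered (ℓ<h′ i d)) inj₁
  Between⇔Inside′ q i d@(no _)  = mk⇔ (λ b → Between-ordered (ℓ<h′ i d) (Between-sym b)) inj₂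

  Between⇔Inside : ∀ q i → Between q (pos M (inj₁ i)) (pos M (inj₂ i)) ⇔ Inside q i
  Between⇔Inside q i = Between⇔Inside′ q i (orientation i)

  Cross⇔′ : ∀ i j d → Cross M i j ⇔
            (Inside (pos M (lo′ j d)) i xor Inside (pos M (hi′ j d)) i)
  Cross⇔′ i j (yes _) = xor-cong-⇔ (Between⇔Inside _ i) (Between⇔Inside _ i)
  Cross⇔′ i j (no _)  = mk⇔ (λ c → xor-comm (Equivalence.to equiv c))
                             (λ c → Equivalence.from equiv (xor-comm c))
    where
    equiv = xor-cong-⇔ (Between⇔Inside (pos M (inj₁ j)) i) (Between⇔Inside (pos M (inj₂ j)) i)

  Cross⇔ : ∀ i j → Cross M i j ⇔ (Inside (ℓ j) i xor Inside (h j) i)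
  Cross⇔ i j = Cross⇔′ i j (orientation j)

  ¬Cross⇒ℓ-inside⇒h-inside : ∀ {a x} → ¬ Cross M a x → Inside (ℓ x) a → Inside (h x) a
  ¬Cross⇒ℓ-inside⇒h-inside {a} {x} ¬cross ℓx∈a with Inside? (h x) a
  ... | yes hx∈a = hx∈a
  ... | no  hx∉a = ⊥-elim (¬cross (Equivalence.from (Cross⇔ a x) (inj₁ (ℓx∈a , hx∉a))))

  ¬Cross⇒ℓ-outside⇒h-outside : ∀ {a x} → ¬ Cross M a x → ¬ Inside (ℓ x) a → ¬ Inside (h x) a
  ¬Cross⇒ℓ-outside⇒h-outside {a} {x} ¬cross ℓx∉a hx∈a =
    ¬cross (Equivalence.from (Cross⇔ a x) (inj₂ (ℓx∉a , hx∈a)))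

  nested-outside⇒¬Cross : ∀ {a x z} → Inside (ℓ x) a → Inside (h x) a →
                          ¬ Inside (ℓ z) a → ¬ Inside (h z) a → ¬ Cross M x z
  nested-outside⇒¬Cross ℓx∈a hx∈a ℓz∉a hz∉a cross with Equivalence.to (Cross⇔ _ _) cross
  ... | inj₁ (ℓz∈x , _) = ℓz∉a (Inside-trans ℓz∈x ℓx∈a hx∈a)
  ... | inj₂ (_ , hz∈x) = hz∉a (Inside-trans hz∈x ℓx∈a hx∈a)

  disjoint⇒h<ℓ : ∀ {x y} → x ≢ y → ℓ x < ℓ y → ¬ Inside (ℓ y) x → h x < ℓ y
  disjoint⇒h<ℓ {x} {y} x≢y ℓx<ℓy ℓy∉x with ℓ y <? h x
  ... | yes ℓy<hx = ⊥-elim (ℓy∉x (ℓx<ℓy , ℓy<hx))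
  ... | no  ℓy≮hx = ≤∧≢⇒< (≮⇒≥ ℓy≮hx) (λ eq → x≢y (h≡ℓ⇒≡ eq))

module CircleModel {n : ℕ} (G : Graph n) (M : ChordModel n) (rep : Represents M G) where
  open Intervals M

  E⇒Cross : ∀ {i j} → E G i j → Cross M i j
  E⇒Cross {i} {j} e = Equivalence.to (rep i j λ { refl → irrefl G e }) e

  ∉N⇒¬Cross : ∀ {a x} → ¬ InClosedNbhd G a x → ¬ Cross M a x
  ∉N⇒¬Cross {a} {x} x∉N[a] cross =
    x∉N[a] (inj₂ (Equivalence.from (rep a x λ a≡x → x∉N[a] (inj₁ (sym a≡x))) cross))

  path-start-∉N : ∀ {a x y} → PathAvoiding G a x y → ¬ InClosedNbhd G a x
  path-start-∉N (here x∉N[a])     = x∉N[a]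
  path-start-∉N (step x∉N[a] _ _) = x∉N[a]

  -- Along an edge x–z both chords avoid a, so x lies wholly inside a or wholly outside it,
  -- and likewise z; since x and z cross, they must lie on the same side.
  PathAvoiding⇒ℓ-inside : ∀ {a x y} → PathAvoiding G a x y → Inside (ℓ x) a → Inside (ℓ y) a
  PathAvoiding⇒ℓ-inside (here _) ℓx∈a = ℓx∈a
  PathAvoiding⇒ℓ-inside {a} (step {x} {z} x∉N[a] xz path) ℓx∈a =
    PathAvoiding⇒ℓ-inside path ℓz∈a
    where
    ℓz∈a : Inside (ℓ z) a
    ℓz∈a with Inside? (ℓ z) a
    ... | yes ℓz∈a = ℓz∈a
    ... | no  ℓz∉a = ⊥-elim (nested-outside⇒¬Cross ℓx∈a
            (¬Cross⇒ℓ-inside⇒h-inside (∉N⇒¬Cross x∉N[a]) ℓx∈a) ℓz∉a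
            (¬Cross⇒ℓ-outside⇒h-outside (∉N⇒¬Cross (path-start-∉N path)) ℓz∉a)
            (E⇒Cross xz))

  module Asteroidal (A : Subset n) (ast : IsAsteroidal G A) where

    Encloses : Fin n → Set
    Encloses x = ∃ λ c → c ∈ A × c ≢ x × Inside (ℓ c) x

    encloses? : ∀ x → Dec (Encloses x)
    encloses? x = any? λ c → (c ∈? A) ×-dec ¬? (c ≟ᶠ x) ×-dec Inside? (ℓ c) x

    encloses⇒encloses-all : ∀ {x} → x ∈ A → Encloses x → ∀ {b} → b ∈ A → b ≢ x → Inside (ℓ b) x
    encloses⇒encloses-all x∈A (c , c∈A , c≢x , ℓc∈x) {b} b∈A b≢x with b ≟ᶠ c
    ... | yes refl = ℓc∈x
    ... | no  b≢c  = PathAvoiding⇒ℓ-inside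
                       (ast _ c b x∈A c∈A b∈A c≢x b≢x λ c≡b → b≢c (sym c≡b)) ℓc∈x

module PolygonSides {k n : ℕ} (P : PolygonModel k n) where
  open Intervals (chords P)

  side-lo<side-hi′ : ∀ i d → side P (lo′ i d) <ᶠ side P (hi′ i d)
  side-lo<side-hi′ i d = ≤∧≢⇒< (side-mono P _ _ (ℓ<h′ i d)) (λ eq → distinct d (toℕ-injective eq))
    where
    distinct : ∀ d → side P (lo′ i d) ≢ side P (hi′ i d)
    distinct (yes _) = side-distinct P i
    distinct (no _)  = λ eq → side-distinct P i (sym eq)

  pos<ℓ⇒side<side-hi : ∀ {e y} → pos (chords P) e < ℓ y → side P e <ᶠ side P (hi y)
  pos<ℓ⇒side<side-hi {e} {y} e<ℓy =
    ≤-<-trans (side-mono P e (lo y) e<ℓy) (side-lo<side-hi′ y (orientation y))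

module PolygonAsteroidal {k n : ℕ} (G : Graph n) (P : PolygonModel k n)
                         (rep : Represents (chords P) G) (A : Subset n) (ast : IsAsteroidal G A) where
  open Intervals (chords P)
  open PolygonSides P
  open CircleModel G (chords P) rep
  open Asteroidal A ast

  sideOf : ∀ x → Dec (Encloses x) → Fin k
  sideOf x (yes _) = side P (lo x)
  sideOf x (no _)  = side P (hi x)

  assignSide : Fin n → Fin k
  assignSide x = sideOf x (encloses? x)

  disjoint⇒sides-distinct : ∀ {x y} → y ∈ A → x ≢ y → ¬ Encloses x → ℓ x < ℓ y →
                            side P (hi x) ≢ side P (hi y)
  disjoint⇒sides-distinct y∈A x≢y ¬enc ℓx<ℓy = <⇒≢ (pos<ℓ⇒side<side-hi
    (disjoint⇒h<ℓ x≢y ℓx<ℓy λ ℓy∈x → ¬enc (_ , y∈A , (λ y≡x → x≢y (sym y≡x)) , ℓy∈x)))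

  sideOf-distinct : ∀ {x y} → x ∈ A → y ∈ A → x ≢ y → ∀ dx dy → sideOf x dx ≢ sideOf y dy
  sideOf-distinct x∈A y∈A x≢y (yes x-enc) (yes y-enc) _ =
    <-asym (proj₁ (encloses⇒encloses-all x∈A x-enc y∈A λ y≡x → x≢y (sym y≡x)))
           (proj₁ (encloses⇒encloses-all y∈A y-enc x∈A x≢y))
  sideOf-distinct x∈A y∈A x≢y (yes x-enc) (no _) = <⇒≢ (pos<ℓ⇒side<side-hi
    (proj₁ (encloses⇒encloses-all x∈A x-enc y∈A λ y≡x → x≢y (sym y≡x))))
  sideOf-distinct x∈A y∈A x≢y (no _) (yes y-enc) eq = <⇒≢ (pos<ℓ⇒side<side-hi
    (proj₁ (encloses⇒encloses-all y∈A y-enc x∈A x≢y))) (sym eq)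
  sideOf-distinct {x} {y} x∈A y∈A x≢y (no ¬x-enc) (no ¬y-enc) eq with <-cmp (ℓ x) (ℓ y)
  ... | tri< ℓx<ℓy _ _ = disjoint⇒sides-distinct y∈A x≢y ¬x-enc ℓx<ℓy eq
  ... | tri≈ _ ℓx≡ℓy _ = x≢y (ℓ-injective ℓx≡ℓy)
  ... | tri> _ _ ℓy<ℓx = disjoint⇒sides-distinct x∈A (λ y≡x → x≢y (sym y≡x)) ¬y-enc ℓy<ℓx (sym eq)

  assignSide-injectiveOn : InjectiveOn A assignSide
  assignSide-injectiveOn {x} {y} x∈A y∈A eq with x ≟ᶠ y
  ... | yes x≡y = x≡y
  ... | no  x≢y = ⊥-elim (sideOf-distinct x∈A y∈A x≢y (encloses? x) (encloses? y) eq)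

asteroidal≤polygon : ∀ {k n} (G : Graph n) → IsPolygonGraph k G →
                     ∀ (A : Subset n) → IsAsteroidal G A → ∣ A ∣ ≤ k
asteroidal≤polygon G (P , rep) A ast =
  injectiveOn⇒∣∣≤ A assignSide assignSide-injectiveOn
  where open PolygonAsteroidal G P rep A ast

theorem5 : ∀ {n} (G : Graph n) → IsCircleGraph G →
           ∀ (ψ a : ℕ) → IsPolygonNumber G ψ → IsAsteroidalNumber G a →
           a ≤ ψ
theorem5 G _ ψ a ((_ , polygon) , _) ((A , ast , ∣A∣≡a) , _) =
  subst (_≤ ψ) ∣A∣≡a (asteroidal≤polygon G polygon A ast)
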